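{- Let $G$ be any graph (not necessarily a Zykov graph). If $H$ is obtained from $G$ by subdividing every edge of $G$ at least once, then $H$ is a Zykov graph.
   Context: Zykov's construction: $Z_1$ is the graph with one vertex. Given $Z_1,\dots,Z_k$ ($k\ge 1$), the graph $Z_{k+1}$ is obtained by taking the disjoint union of $Z_1,\dots,Z_k$ and, for each $k$-tuple $(v_1,\dots,v_k)$ with $v_i\in V(Z_i)$, adding a new vertex adjacent exactly to $v_1,\dots,v_k$. A Zykov graph is any graph isomorphic to an induced subgraph of $Z_k$ for some integer $k\ge 1$. -}

module Defs where

open import Data.Nat using (ℕ; zero; suc)
open import Data.Fin using (Fin; toℕ) renaming (_<_ to _<ᶠ_)
open import Data.Bool using (Bool; true; false)
open import Data.Empty using (⊥)
open import Data.Unit using (⊤)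
open import Data.Sum using (_⊎_; inj₁; inj₂)
open import Data.Product using (Σ; _×_; _,_; ∃-syntax)
open import Data.List using (List; []; _∷_; _++_)
open import Relation.Binary.PropositionalEquality using (_≡_)
open import Function using (Injective; _⇔_)

record Graph : Set₁ where
  field
    V   : Set
    Adj : V → V → Set
open Graph public

-- For a list gs = [G₁,…,Gₖ] of graphs, `step gs` is the disjoint union of
-- the Gᵢ together with one new vertex per k-tuple (v₁,…,vₖ), vᵢ ∈ V(Gᵢ),
-- adjacent exactly to v₁,…,vₖ.  (For gs = [] this is the one-vertex graph.)

DU : List Graph → Set
DU []       = ⊥
DU (g ∷ gs) = V g ⊎ DU gs

DUAdj : (gs : List Graph) → DU gs → DU gs → Set
DUAdj []       ()       _
DUAdj (g ∷ gs) (inj₁ a) (inj₁ b) = Adj g a b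
DUAdj (g ∷ gs) (inj₁ a) (inj₂ b) = ⊥
DUAdj (g ∷ gs) (inj₂ a) (inj₁ b) = ⊥
DUAdj (g ∷ gs) (inj₂ a) (inj₂ b) = DUAdj gs a b

Tup : List Graph → Set
Tup []       = ⊤
Tup (g ∷ gs) = V g × Tup gs

InTup : (gs : List Graph) → Tup gs → DU gs → Set
InTup []       _       ()
InTup (g ∷ gs) (v , t) (inj₁ u) = v ≡ u
InTup (g ∷ gs) (v , t) (inj₂ d) = InTup gs t d

StepV : List Graph → Set
StepV gs = DU gs ⊎ Tup gs

StepAdj : (gs : List Graph) → StepV gs → StepV gs → Set
StepAdj gs (inj₁ a) (inj₁ b) = DUAdj gs a b
StepAdj gs (inj₁ a) (inj₂ t) = InTup gs t a
StepAdj gs (inj₂ t) (inj₁ a) = InTup gs t a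
StepAdj gs (inj₂ t) (inj₂ s) = ⊥

step : List Graph → Graph
step gs = record { V = StepV gs ; Adj = StepAdj gs }

zs : ℕ → List Graph
zs zero    = []
zs (suc k) = zs k ++ (step (zs k) ∷ [])

-- Z m is Zykov's graph Z_{m+1}  (so Z 0 = Z₁ is the one-vertex graph).
Z : ℕ → Graph
Z m = step (zs m)

InducedEmbedding : Graph → Graph → Set
InducedEmbedding H G' =
  Σ (V H → V G') λ f →
    Injective _≡_ _≡_ f × (∀ u v → Adj H u v ⇔ Adj G' (f u) (f v))

IsZykov : Graph → Set
IsZykov H = ∃[ m ] InducedEmbedding H (Z m)

record FinGraph : Set where
  field
    n     : ℕ
    adj   : Fin n → Fin n → Bool
    sym   : ∀ u v → adj u v ≡ adj v u
    irrfl : ∀ u → adj u u ≡ false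
open FinGraph public

Edge : FinGraph → Set
Edge G = Σ (Fin (n G)) λ u → Σ (Fin (n G)) λ v → (u <ᶠ v) × (adj G u v ≡ true)

-- Subdivision of every edge: edge e = {u,v} (u < v) is replaced by a path
-- u – m₀ – m₁ – … – m_{t e} – v with t e + 1 ≥ 1 new internal vertices.
module _ (G : FinGraph) (t : Edge G → ℕ) where

  SubV : Set
  SubV = Fin (n G) ⊎ (Σ (Edge G) λ e → Fin (suc (t e)))

  Link : Fin (n G) → (Σ (Edge G) λ e → Fin (suc (t e))) → Set
  Link a (e@(u , v , _ , _) , i) = (a ≡ u × toℕ i ≡ 0) ⊎ (a ≡ v × toℕ i ≡ t e)

  Inner : (Σ (Edge G) λ e → Fin (suc (t e))) → (Σ (Edge G) λ e → Fin (suc (t e))) → Set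
  Inner ((u , v , _ , _) , i) ((u' , v' , _ , _) , j) =
    u ≡ u' × v ≡ v' × (suc (toℕ i) ≡ toℕ j ⊎ suc (toℕ j) ≡ toℕ i)

  SubAdj : SubV → SubV → Set
  SubAdj (inj₁ a) (inj₁ b) = ⊥
  SubAdj (inj₁ a) (inj₂ x) = Link a x
  SubAdj (inj₂ x) (inj₁ a) = Link a x
  SubAdj (inj₂ x) (inj₂ y) = Inner x y

  Subdivide : Graph
  Subdivide = record { V = SubV ; Adj = SubAdj }

-- Z (m + 1) is the disjoint union of Z 0, …, Z m together with one vertex for every choice of
-- a vertex in each summand, adjacent exactly to the chosen vertices.  Such tuple vertices are
-- pairwise non-adjacent and see exactly one vertex in each summand.  Hence Z (k + 1) contains
-- the path 0 – 1 – 2 – … as an induced subgraph: position i, if even, is a fixed vertex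
-- (the mark) of summand i + 1; if odd, it is the tuple vertex choosing the mark in the two
-- summands of its neighbours and another vertex everywhere else.
--
-- The subdivision embeds into a single Z (M + 1): each subdivided edge uv becomes such a path
-- in its own summand slot(u, v), and an original vertex a becomes the tuple vertex choosing,
-- in slot(u, v), the first path vertex if a = u, the last one if a = v and one past the end
-- otherwise; in summand a + 1 it chooses the mark, which keeps distinct original vertices
-- apart.  Since every edge is subdivided, original vertices are pairwise non-adjacent, as
-- tuple vertices must be.

module Submission where

open import Defs hiding (sym)
open import Data.Nat using (ℕ; zero; suc; _+_; _*_; _∸_; _⊔_; _≤_; _<_; z≤n; s≤s; z<s; _≤?_; _<?_; parity)
open import Data.Nat.Properties
open import Data.Fin as Fin using (Fin; toℕ; fromℕ<; combine; remQuot)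
import Data.Fin.Properties as Fin
open import Data.Bool using (true)
import Data.Bool.Properties as Bool
open import Data.Empty using (⊥-elim)
open import Data.Unit using (tt)
open import Data.Sum using (_⊎_; inj₁; inj₂; [_,_])
open import Data.Sum.Properties using (inj₁-injective; inj₂-injective)
open import Data.Product using (Σ; _×_; _,_; proj₁; proj₂; ∃)
open import Data.List using (List; []; _∷_; _++_)
open import Data.Maybe using (Maybe; just; nothing)
open import Data.Parity using (Parity; 0ℙ; 1ℙ)
open import Data.Parity.Properties using (p≢p⁻¹; suc-homo-⁻¹)
open import Function using (id; _∘_; _⇔_; mk⇔; Equivalence)
import Function.Properties.Equivalence as ⇔
open import Relation.Binary.PropositionalEquality hiding ([_])
open import Relation.Nullary using (¬_; yes; no; _⊎-dec_)
open import Relation.Unary using (Pred; Decidable)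
open import Level using (0ℓ)
import Axiom.UniquenessOfIdentityProofs as UIP

≡⇒⇔ : ∀ {A B : Set} → A ≡ B → A ⇔ B
≡⇒⇔ refl = ⇔.refl

prefix : (ℕ → Graph) → ℕ → List Graph
prefix f zero    = []
prefix f (suc m) = f 0 ∷ prefix (f ∘ suc) m

prefix-suc : ∀ f m → prefix f (suc m) ≡ prefix f m ++ f m ∷ []
prefix-suc f zero    = refl
prefix-suc f (suc m) = cong (f 0 ∷_) (prefix-suc (f ∘ suc) m)

zs≡prefix : ∀ m → zs m ≡ prefix Z m
zs≡prefix zero    = refl
zs≡prefix (suc m) = trans (cong (_++ Z m ∷ []) (zs≡prefix m)) (sym (prefix-suc Z m))

inject : ∀ f {m} k → k < m → V (f k) → DU (prefix f m)
inject f zero    (s≤s _) a = inj₁ a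
inject f (suc k) (s≤s p) a = inj₂ (inject (f ∘ suc) k p a)

tuple : ∀ f m → (∀ k → V (f k)) → Tup (prefix f m)
tuple f zero    c = tt
tuple f (suc m) c = c 0 , tuple (f ∘ suc) m (c ∘ suc)

DUAdj-inject : ∀ f {m} k (p q : k < m) a b →
               DUAdj (prefix f m) (inject f k p a) (inject f k q b) ≡ Adj (f k) a b
DUAdj-inject f zero    (s≤s _) (s≤s _) a b = refl
DUAdj-inject f (suc k) (s≤s p) (s≤s q) a b = DUAdj-inject (f ∘ suc) k p q a b

DUAdj-inject-≢ : ∀ f {m k l} (p : k < m) (q : l < m) a b → k ≢ l →
                 ¬ DUAdj (prefix f m) (inject f k p a) (inject f l q b)
DUAdj-inject-≢ f {k = zero}  {zero}  (s≤s _) (s≤s _) a b k≢l _ = k≢l refl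
DUAdj-inject-≢ f {k = suc k} {suc l} (s≤s p) (s≤s q) a b k≢l =
  DUAdj-inject-≢ (f ∘ suc) p q a b (k≢l ∘ cong suc)

InTup-tuple : ∀ f {m} c k (p : k < m) a →
              InTup (prefix f m) (tuple f m c) (inject f k p a) ≡ (c k ≡ a)
InTup-tuple f c zero    (s≤s _) a = refl
InTup-tuple f c (suc k) (s≤s p) a = InTup-tuple (f ∘ suc) (c ∘ suc) k p a

inject-injectiveᵢ : ∀ f {m} k l (p : k < m) (q : l < m) a b →
                    inject f k p a ≡ inject f l q b → k ≡ l
inject-injectiveᵢ f zero    zero    (s≤s _) (s≤s _) a b _  = refl
inject-injectiveᵢ f (suc k) (suc l) (s≤s p) (s≤s q) a b eq =
  cong suc (inject-injectiveᵢ (f ∘ suc) k l p q a b (inj₂-injective eq))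

inject-injective : ∀ f {m} k (p q : k < m) {a b} → inject f k p a ≡ inject f k q b → a ≡ b
inject-injective f zero    (s≤s _) (s≤s _) refl = refl
inject-injective f (suc k) (s≤s p) (s≤s q) eq   = inject-injective (f ∘ suc) k p q (inj₂-injective eq)

tuple-injective : ∀ f m {c c′} → tuple f m c ≡ tuple f m c′ → ∀ k → k < m → c k ≡ c′ k
tuple-injective f (suc m) eq zero    _       = cong proj₁ eq
tuple-injective f (suc m) eq (suc k) (s≤s p) = tuple-injective (f ∘ suc) m (cong proj₂ eq) k p

StepAdj-subst : ∀ {gs hs} (e : gs ≡ hs) x y →
                StepAdj hs (subst StepV e x) (subst StepV e y) ≡ StepAdj gs x y
StepAdj-subst refl x y = refl

fromPrefix : ∀ m → StepV (prefix Z m) → V (Z m)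
fromPrefix m = subst StepV (sym (zs≡prefix m))

Adj-fromPrefix : ∀ m x y → Adj (Z m) (fromPrefix m x) (fromPrefix m y) ≡ StepAdj (prefix Z m) x y
Adj-fromPrefix m = StepAdj-subst (sym (zs≡prefix m))

fromPrefix-injective : ∀ m {x y} → fromPrefix m x ≡ fromPrefix m y → x ≡ y
fromPrefix-injective m = subst-injective (sym (zs≡prefix m))

-- Opaque, so that type checking never unfolds zs m: every use goes through the lemmas below.
opaque
  summand : ∀ {m} k → k < m → V (Z k) → V (Z m)
  summand {m} k p a = fromPrefix m (inj₁ (inject Z k p a))

  tupleVertex : ∀ m → (∀ k → V (Z k)) → V (Z m)
  tupleVertex m c = fromPrefix m (inj₂ (tuple Z m c))

opaque
  unfolding summand tupleVertex

  summand-adj : ∀ {m} k (p q : k < m) a b → Adj (Z m) (summand k p a) (summand k q b) ≡ Adj (Z k) a b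
  summand-adj {m} k p q a b = trans (Adj-fromPrefix m _ _) (DUAdj-inject Z k p q a b)

  summand-nonadj : ∀ {m k l} (p : k < m) (q : l < m) a b → k ≢ l →
                   ¬ Adj (Z m) (summand k p a) (summand l q b)
  summand-nonadj {m} p q a b k≢l = DUAdj-inject-≢ Z p q a b k≢l ∘ subst id (Adj-fromPrefix m _ _)

  tupleVertex-summand-adj : ∀ {m} c k (p : k < m) a →
                            Adj (Z m) (tupleVertex m c) (summand k p a) ≡ (c k ≡ a)
  tupleVertex-summand-adj {m} c k p a = trans (Adj-fromPrefix m _ _) (InTup-tuple Z c k p a)

  summand-tupleVertex-adj : ∀ {m} c k (p : k < m) a →
                            Adj (Z m) (summand k p a) (tupleVertex m c) ≡ (c k ≡ a)
  summand-tupleVertex-adj {m} c k p a = trans (Adj-fromPrefix m _ _) (InTup-tuple Z c k p a)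

  tupleVertex-nonadj : ∀ {m} c c′ → ¬ Adj (Z m) (tupleVertex m c) (tupleVertex m c′)
  tupleVertex-nonadj {m} c c′ = subst id (Adj-fromPrefix m _ _)

  summand-injectiveᵢ : ∀ {m k l} (p : k < m) (q : l < m) {a b} →
                       summand k p a ≡ summand l q b → k ≡ l
  summand-injectiveᵢ {m} p q = inject-injectiveᵢ Z _ _ p q _ _ ∘ inj₁-injective ∘ fromPrefix-injective m

  summand-injective : ∀ {m} k (p q : k < m) {a b} → summand k p a ≡ summand k q b → a ≡ b
  summand-injective {m} k p q = inject-injective Z k p q ∘ inj₁-injective ∘ fromPrefix-injective m

  tupleVertex-injective : ∀ {m c c′} → tupleVertex m c ≡ tupleVertex m c′ → ∀ k → k < m → c k ≡ c′ k
  tupleVertex-injective {m} = tuple-injective Z m ∘ inj₂-injective ∘ fromPrefix-injective m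

  summand≢tupleVertex : ∀ {m} k (p : k < m) a c → summand k p a ≢ tupleVertex m c
  summand≢tupleVertex {m} k p a c eq with fromPrefix-injective m eq
  ... | ()

point : ∀ k → V (Z k)
point zero    = inj₂ tt
point (suc k) = summand {suc k} 0 z<s (point 0)

mark : ∀ k → V (Z (suc k))
mark k = tupleVertex (suc k) point

mark≢point : ∀ k → mark k ≢ point (suc k)
mark≢point k = summand≢tupleVertex {suc k} 0 z<s (point 0) point ∘ sym

indicator : (P : Pred ℕ 0ℓ) → Decidable P → ∀ k → V (Z k)
indicator P P? zero    = point zero
indicator P P? (suc k) with P? (suc k)
... | yes _ = mark k
... | no  _ = point (suc k)

indicator-mark : ∀ P (P? : Decidable P) k → indicator P P? (suc k) ≡ mark k ⇔ P (suc k)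
indicator-mark P P? k with P? (suc k)
... | yes p  = mk⇔ (λ _ → p) (λ _ → refl)
... | no  ¬p = mk⇔ (⊥-elim ∘ mark≢point k ∘ sym) (⊥-elim ∘ ¬p)

Consecutive : ℕ → ℕ → Set
Consecutive i j = suc i ≡ j ⊎ suc j ≡ i

Consecutive-sym : ∀ {i j} → Consecutive i j → Consecutive j i
Consecutive-sym = [ inj₂ , inj₁ ]

parity≢parity-suc : ∀ i → parity i ≢ parity (suc i)
parity≢parity-suc i e = p≢p⁻¹ (parity (suc i)) (trans (sym e) (sym (suc-homo-⁻¹ i)))

parity≡⇒¬Consecutive : ∀ {i j} → parity i ≡ parity j → ¬ Consecutive i j
parity≡⇒¬Consecutive {i}     e (inj₁ refl) = parity≢parity-suc i e
parity≡⇒¬Consecutive {j = j} e (inj₂ refl) = parity≢parity-suc j (sym e)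

Rung : ℕ → Pred ℕ 0ℓ
Rung i c = c ≡ i ⊎ c ≡ suc (suc i)

Rung? : ∀ i → Decidable (Rung i)
Rung? i c = (c ≟ i) ⊎-dec (c ≟ suc (suc i))

-- The choice of the odd path vertex i: the marks of summands i and i + 2, which hold its
-- neighbours i - 1 and i + 1.
rungs : ℕ → ∀ c → V (Z c)
rungs i = indicator (Rung i) (Rung? i)

rungs-mark : ∀ i j → rungs i (suc j) ≡ mark j ⇔ Consecutive i j
rungs-mark i j = ⇔.trans (indicator-mark (Rung i) (Rung? i) j)
  (mk⇔ [ inj₂ , inj₁ ∘ suc-injective ∘ sym ] [ inj₂ ∘ cong suc ∘ sym , inj₁ ])

pathVertexᵖ : ∀ {k} i → suc i < k → Parity → V (Z k)
pathVertexᵖ     i p 0ℙ = summand (suc i) p (mark i)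
pathVertexᵖ {k} i p 1ℙ = tupleVertex k (rungs i)

pathVertex : ∀ {k} i → suc i < k → V (Z k)
pathVertex i p = pathVertexᵖ i p (parity i)

module _ {k : ℕ} where

  pathVertex-adj : ∀ i j (p : suc i < k) (q : suc j < k) →
                   Adj (Z k) (pathVertex i p) (pathVertex j q) ⇔ Consecutive i j
  pathVertex-adj i j p q = byParity (parity i) (parity j) refl refl
    where
    sameParity : ∀ {x} → parity i ≡ x → parity j ≡ x →
                 ¬ Adj (Z k) (pathVertexᵖ i p x) (pathVertexᵖ j q x) →
                 Adj (Z k) (pathVertexᵖ i p x) (pathVertexᵖ j q x) ⇔ Consecutive i j
    sameParity ei ej ¬adj = mk⇔ (⊥-elim ∘ ¬adj) (⊥-elim ∘ parity≡⇒¬Consecutive (trans ei (sym ej)))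

    byParity : ∀ x y → parity i ≡ x → parity j ≡ y →
               Adj (Z k) (pathVertexᵖ i p x) (pathVertexᵖ j q y) ⇔ Consecutive i j
    byParity 0ℙ 0ℙ ei ej = sameParity ei ej evens
      where
      evens : ¬ Adj (Z k) (summand (suc i) p (mark i)) (summand (suc j) q (mark j))
      evens with i ≟ j
      ... | yes refl = tupleVertex-nonadj {suc i} point point ∘ subst id (summand-adj (suc i) p q _ _)
      ... | no  i≢j  = summand-nonadj p q _ _ (i≢j ∘ suc-injective)
    byParity 0ℙ 1ℙ _ _ = ⇔.trans (≡⇒⇔ (summand-tupleVertex-adj (rungs j) (suc i) p (mark i)))
                                 (⇔.trans (rungs-mark j i) (mk⇔ Consecutive-sym Consecutive-sym))
    byParity 1ℙ 0ℙ _ _ = ⇔.trans (≡⇒⇔ (tupleVertex-summand-adj (rungs i) (suc j) q (mark j)))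
                                 (rungs-mark i j)
    byParity 1ℙ 1ℙ ei ej = sameParity ei ej (tupleVertex-nonadj {k} (rungs i) (rungs j))

  rungs-agree⇒Consecutive : ∀ i j → suc (suc i) < k →
                            (∀ c → c < k → rungs (suc i) c ≡ rungs j c) → Consecutive j i
  rungs-agree⇒Consecutive i j p r = Equivalence.to (rungs-mark j i)
    (trans (sym (r (suc i) (<⇒≤ p))) (Equivalence.from (rungs-mark (suc i) i) (inj₂ refl)))

  pathVertex-injective : ∀ i j (p : suc i < k) (q : suc j < k) → pathVertex i p ≡ pathVertex j q → i ≡ j
  pathVertex-injective i j p q = byParity (parity i) (parity j) refl refl
    where
    odd : ∀ i j → suc i < k → suc j < k → parity i ≡ 1ℙ → parity j ≡ 1ℙ →
          (∀ c → c < k → rungs i c ≡ rungs j c) → i ≡ j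
    odd (suc i′) (suc j′) p q _ _ r =
      resolve (rungs-agree⇒Consecutive i′ (suc j′) p r)
              (rungs-agree⇒Consecutive j′ (suc i′) q (λ c c<k → sym (r c c<k)))
      where
      resolve : Consecutive (suc j′) i′ → Consecutive (suc i′) j′ → suc i′ ≡ suc j′
      resolve (inj₂ e)  _         = e
      resolve _         (inj₂ e)  = sym e
      resolve (inj₁ e₁) (inj₁ e₂) = ⊥-elim (m≢1+n+m i′ (trans (sym e₁) (cong (suc ∘ suc) (sym e₂))))

    byParity : ∀ x y → parity i ≡ x → parity j ≡ y → pathVertexᵖ i p x ≡ pathVertexᵖ j q y → i ≡ j
    byParity 0ℙ 0ℙ _  _  e = suc-injective (summand-injectiveᵢ p q e)
    byParity 0ℙ 1ℙ _  _  e = ⊥-elim (summand≢tupleVertex _ p _ _ e)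
    byParity 1ℙ 0ℙ _  _  e = ⊥-elim (summand≢tupleVertex _ q _ _ (sym e))
    byParity 1ℙ 1ℙ ei ej e = odd i j p q ei ej (tupleVertex-injective e)

  pathVertex-cong : ∀ {i j} (p : suc i < k) (q : suc j < k) → i ≡ j → pathVertex i p ≡ pathVertex j q
  pathVertex-cong p q refl = cong (pathVertex _) (<-irrelevant p q)

Fin-bounded : ∀ {n} (f : Fin n → ℕ) → ∃ λ B → ∀ i → f i ≤ B
Fin-bounded {zero}  f = 0 , λ ()
Fin-bounded {suc n} f with Fin-bounded (f ∘ Fin.suc)
... | B , f≤B = f Fin.zero ⊔ B , λ where
  Fin.zero    → m≤m⊔n _ B
  (Fin.suc i) → m≤n⇒m≤o⊔n (f Fin.zero) (f≤B i)

module SubdivisionInZykov (G : FinGraph) (t : Edge G → ℕ) where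

  N : ℕ
  N = n G

  weight : Fin N → Fin N → ℕ
  weight u v with toℕ u <? toℕ v | adj G u v Bool.≟ true
  ... | yes u<v | yes uv = t (u , v , u<v , uv)
  ... | _       | _      = 0

  weight-edge : ∀ u v u<v uv → t (u , v , u<v , uv) ≡ weight u v
  weight-edge u v u<v uv with toℕ u <? toℕ v | adj G u v Bool.≟ true
  ... | yes u<v′ | yes uv′ =
    cong₂ (λ p q → t (u , v , p , q)) (<-irrelevant u<v u<v′) (UIP.Decidable⇒UIP.≡-irrelevant Bool._≟_ uv uv′)
  ... | no u≮v   | _       = ⊥-elim (u≮v u<v)
  ... | yes _    | no ¬uv  = ⊥-elim (¬uv uv)

  weight-bounded : ∃ λ X → ∀ u v → weight u v ≤ X
  weight-bounded with Fin-bounded (λ u → proj₁ (Fin-bounded (weight u)))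
  ... | X , rows≤X = X , λ u v → ≤-trans (proj₂ (Fin-bounded (weight u)) v) (rows≤X u)

  X : ℕ
  X = proj₁ weight-bounded

  weight≤X : ∀ u v → weight u v ≤ X
  weight≤X = proj₂ weight-bounded

  -- Summands 1, …, N are reserved for the original vertices; from base on, the summand
  -- slot u v has room for a path on weight u v + 2 vertices.
  base : ℕ
  base = suc (suc (suc (X + N)))

  slot : Fin N → Fin N → ℕ
  slot u v = base + toℕ (combine u v)

  M : ℕ
  M = base + N * N

  slot<1+M : ∀ u v → slot u v < suc M
  slot<1+M u v = s≤s (<⇒≤ (+-monoʳ-< base (Fin.toℕ<n (combine u v))))

  slot-injective : ∀ {u v u′ v′} → slot u v ≡ slot u′ v′ → u ≡ u′ × v ≡ v′
  slot-injective {u} {v} {u′} {v′} e =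
    Fin.combine-injective u v u′ v′ (Fin.toℕ-injective (+-cancelˡ-≡ base _ _ e))

  1+a<base : ∀ (a : Fin N) → suc (toℕ a) < base
  1+a<base a = s≤s (s≤s (m≤n⇒m≤1+n (≤-trans (<⇒≤ (Fin.toℕ<n a)) (m≤n+m N X))))

  1+a<1+M : ∀ (a : Fin N) → suc (toℕ a) < suc M
  1+a<1+M a = ≤-trans (1+a<base a) (m≤n⇒m≤1+n (m≤m+n base (N * N)))

  slotOf : ∀ k → Maybe ((Fin N × Fin N) × base ≤ k)
  slotOf k with base ≤? k
  ... | no _ = nothing
  ... | yes b with k ∸ base <? N * N
  ...   | no _  = nothing
  ...   | yes q = just (remQuot N (fromℕ< q) , b)

  slotOf-slot : ∀ u v → ∃ λ b → slotOf (slot u v) ≡ just ((u , v) , b)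
  slotOf-slot u v with base ≤? slot u v
  ... | no b≰s = ⊥-elim (b≰s (m≤m+n base _))
  ... | yes b with slot u v ∸ base <? N * N
  ...   | no ¬q = ⊥-elim (¬q (subst (_< N * N) (sym (m+n∸m≡n base _)) (Fin.toℕ<n (combine u v))))
  ...   | yes q = b , cong (λ x → just (x , b)) (trans (cong (remQuot N) fromℕ<q≡uv) (Fin.remQuot-combine u v))
    where
    fromℕ<q≡uv : fromℕ< q ≡ combine u v
    fromℕ<q≡uv = Fin.toℕ-injective (trans (Fin.toℕ-fromℕ< q) (m+n∸m≡n base _))

  slotOf-< : ∀ k → k < base → slotOf k ≡ nothing
  slotOf-< k k<b with base ≤? k
  ... | no _  = refl
  ... | yes b = ⊥-elim (<⇒≱ k<b b)

  pathRoom : ∀ u v {j k} → j ≤ suc (weight u v) → base ≤ k → suc j < k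
  pathRoom u v j≤ b = ≤-trans (s≤s (s≤s (≤-trans j≤ (s≤s (≤-trans (weight≤X u v) (m≤m+n X N)))))) b

  endpointIndex : Fin N → Fin N → Fin N → ℕ
  endpointIndex a u v with a Fin.≟ u | a Fin.≟ v
  ... | yes _ | _     = 0
  ... | no _  | yes _ = weight u v
  ... | no _  | no _  = suc (weight u v)

  endpointIndex≤ : ∀ a u v → endpointIndex a u v ≤ suc (weight u v)
  endpointIndex≤ a u v with a Fin.≟ u | a Fin.≟ v
  ... | yes _ | _     = z≤n
  ... | no _  | yes _ = n≤1+n _
  ... | no _  | no _  = ≤-refl

  Link⇔endpointIndex : ∀ a u v u<v uv (i : Fin (suc (t (u , v , u<v , uv)))) →
                       Link G t a ((u , v , u<v , uv) , i) ⇔ endpointIndex a u v ≡ toℕ i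
  Link⇔endpointIndex a u v u<v uv i with a Fin.≟ u | a Fin.≟ v
  ... | yes refl | _ = mk⇔ [ sym ∘ proj₂ , ⊥-elim ∘ u≢v ∘ proj₁ ] (λ e → inj₁ (refl , sym e))
    where
    u≢v : a ≢ v
    u≢v refl = <-irrefl refl u<v
  ... | no a≢u | yes refl =
    mk⇔ [ ⊥-elim ∘ a≢u ∘ proj₁ , sym ∘ at-end ∘ proj₂ ] (λ e → inj₂ (refl , from-end (sym e)))
    where
    at-end : toℕ i ≡ t (u , a , u<v , uv) → toℕ i ≡ weight u a
    at-end e = trans e (weight-edge u a u<v uv)
    from-end : toℕ i ≡ weight u a → toℕ i ≡ t (u , a , u<v , uv)
    from-end e = trans e (sym (weight-edge u a u<v uv))
  ... | no a≢u | no a≢v = mk⇔ [ ⊥-elim ∘ a≢u ∘ proj₁ , ⊥-elim ∘ a≢v ∘ proj₁ ] (⊥-elim ∘ past-end)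
    where
    past-end : suc (weight u v) ≢ toℕ i
    past-end e = <⇒≱ (≤-reflexive e) (subst (toℕ i ≤_) (weight-edge u v u<v uv) (Fin.toℕ≤pred[n] i))

  coordinate : Fin N → ∀ k → V (Z k)
  coordinate a k with slotOf k
  ... | just ((u , v) , b) = pathVertex {k} (endpointIndex a u v) (pathRoom u v (endpointIndex≤ a u v) b)
  ... | nothing            = indicator (_≡ suc (toℕ a)) (_≟ suc (toℕ a)) k

  coordinate-slot : ∀ a u v → ∃ λ p → coordinate a (slot u v) ≡ pathVertex {slot u v} (endpointIndex a u v) p
  coordinate-slot a u v with slotOf (slot u v) | slotOf-slot u v
  ... | _ | b , refl = _ , refl

  coordinate-mark : ∀ a b → coordinate b (suc (toℕ a)) ≡ mark (toℕ a) ⇔ a ≡ b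
  coordinate-mark a b with slotOf (suc (toℕ a)) | slotOf-< (suc (toℕ a)) (1+a<base a)
  ... | _ | refl = ⇔.trans (indicator-mark _ (_≟ suc (toℕ b)) (toℕ a))
                           (mk⇔ (Fin.toℕ-injective ∘ suc-injective) (cong (suc ∘ toℕ)))

  internalRoom : ∀ u v u<v uv (i : Fin (suc (t (u , v , u<v , uv)))) → suc (toℕ i) < slot u v
  internalRoom u v u<v uv i =
    pathRoom u v (m≤n⇒m≤1+n (subst (toℕ i ≤_) (weight-edge u v u<v uv) (Fin.toℕ≤pred[n] i))) (m≤m+n base _)

  internal-≡ : ∀ {u v u<v uv i u′ v′ u<v′ uv′ j} → u ≡ u′ → v ≡ v′ → toℕ i ≡ toℕ j →
               _≡_ {A = Σ (Edge G) λ e → Fin (suc (t e))} ((u , v , u<v , uv) , i) ((u′ , v′ , u<v′ , uv′) , j)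
  internal-≡ {u<v = u<v} {uv} {u<v′ = u<v′} {uv′} refl refl i≡j
    with <-irrelevant u<v u<v′ | UIP.Decidable⇒UIP.≡-irrelevant Bool._≟_ uv uv′
  ... | refl | refl = cong (_ ,_) (Fin.toℕ-injective i≡j)

  embed : SubV G t → V (Z (suc M))
  embed (inj₁ a)                        = tupleVertex (suc M) (coordinate a)
  embed (inj₂ ((u , v , u<v , uv) , i)) =
    summand (slot u v) (slot<1+M u v) (pathVertex {slot u v} (toℕ i) (internalRoom u v u<v uv i))

  Link⇔coordinate : ∀ a u v u<v uv i → Link G t a ((u , v , u<v , uv) , i) ⇔
                    coordinate a (slot u v) ≡ pathVertex (toℕ i) (internalRoom u v u<v uv i)
  Link⇔coordinate a u v u<v uv i with coordinate-slot a u v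
  ... | p , e = ⇔.trans (Link⇔endpointIndex a u v u<v uv i)
                        (mk⇔ (trans e ∘ pathVertex-cong p _) (pathVertex-injective _ _ p _ ∘ trans (sym e)))

  slot-path-adj : ∀ {m u v u′ v′ i j} (s : slot u v < m) (s′ : slot u′ v′ < m)
                  (p : suc i < slot u v) (q : suc j < slot u′ v′) →
                  (u ≡ u′ × v ≡ v′ × Consecutive i j) ⇔
                  Adj (Z m) (summand (slot u v) s (pathVertex i p)) (summand (slot u′ v′) s′ (pathVertex j q))
  slot-path-adj {u = u} {v} {u′} {v′} {i} {j} s s′ p q with u Fin.≟ u′ | v Fin.≟ v′
  ... | yes refl | yes refl =
    ⇔.trans (mk⇔ (proj₂ ∘ proj₂) (λ c → refl , refl , c))
            (⇔.trans (⇔.sym (pathVertex-adj i j p q)) (⇔.sym (≡⇒⇔ (summand-adj _ s s′ _ _))))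
  ... | no u≢u′ | _ =
    mk⇔ (⊥-elim ∘ u≢u′ ∘ proj₁) (⊥-elim ∘ summand-nonadj s s′ _ _ (u≢u′ ∘ proj₁ ∘ slot-injective))
  ... | _ | no v≢v′ =
    mk⇔ (⊥-elim ∘ v≢v′ ∘ proj₁ ∘ proj₂) (⊥-elim ∘ summand-nonadj s s′ _ _ (v≢v′ ∘ proj₂ ∘ slot-injective))

  slot-path-injective : ∀ {m u v u′ v′ i j} (s : slot u v < m) (s′ : slot u′ v′ < m)
                        (p : suc i < slot u v) (q : suc j < slot u′ v′) →
                        summand (slot u v) s (pathVertex i p) ≡ summand (slot u′ v′) s′ (pathVertex j q) →
                        u ≡ u′ × v ≡ v′ × i ≡ j
  slot-path-injective s s′ p q e with slot-injective (summand-injectiveᵢ s s′ e)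
  ... | refl , refl = refl , refl , pathVertex-injective _ _ p q (summand-injective _ s s′ e)

  embed-adj : ∀ x y → SubAdj G t x y ⇔ Adj (Z (suc M)) (embed x) (embed y)
  embed-adj (inj₁ a) (inj₁ b) = mk⇔ (λ ()) (tupleVertex-nonadj {suc M} (coordinate a) (coordinate b))
  embed-adj (inj₁ a) (inj₂ ((u , v , u<v , uv) , i)) =
    ⇔.trans (Link⇔coordinate a u v u<v uv i)
            (⇔.sym (≡⇒⇔ (tupleVertex-summand-adj (coordinate a) (slot u v) (slot<1+M u v) _)))
  embed-adj (inj₂ ((u , v , u<v , uv) , i)) (inj₁ a) =
    ⇔.trans (Link⇔coordinate a u v u<v uv i)
            (⇔.sym (≡⇒⇔ (summand-tupleVertex-adj (coordinate a) (slot u v) (slot<1+M u v) _)))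
  embed-adj (inj₂ ((u , v , _ , _) , i)) (inj₂ ((u′ , v′ , _ , _) , j)) =
    slot-path-adj (slot<1+M u v) (slot<1+M u′ v′) _ _

  embed-injective : ∀ {x y} → embed x ≡ embed y → x ≡ y
  embed-injective {inj₁ a} {inj₁ b} e = cong inj₁ (Equivalence.to (coordinate-mark a b)
    (trans (sym (tupleVertex-injective {suc M} e (suc (toℕ a)) (1+a<1+M a)))
           (Equivalence.from (coordinate-mark a a) refl)))
  embed-injective {inj₁ a} {inj₂ _} e = ⊥-elim (summand≢tupleVertex {suc M} _ _ _ _ (sym e))
  embed-injective {inj₂ _} {inj₁ b} e = ⊥-elim (summand≢tupleVertex {suc M} _ _ _ _ e)
  embed-injective {inj₂ ((u , v , _ , _) , i)} {inj₂ ((u′ , v′ , _ , _) , j)} e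
    with slot-path-injective (slot<1+M u v) (slot<1+M u′ v′) _ _ e
  ... | u≡u′ , v≡v′ , i≡j = cong inj₂ (internal-≡ u≡u′ v≡v′ i≡j)

  embedding : InducedEmbedding (Subdivide G t) (Z (suc M))
  embedding = embed , embed-injective , embed-adj

lemma8 : (G : FinGraph) (t : Edge G → ℕ) → IsZykov (Subdivide G t)
lemma8 G t = suc M , embedding
  where open SubdivisionInZykov G t
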